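{- Let $n=n_1+\cdots+n_r$ with $r\ge1$ and positive integers $n_i$, let $N_0=0$, $N_i=n_1+\cdots+n_i$, and let $b_1,\dots,b_n$ be positive integers. Let $\Delta\subset\mathbb{R}^{n+1}$ be the convex hull of $V_0=0$, $V_1,\dots,V_{n+1}$ and $V_{n+2},\dots,V_{n+r+1}$ as defined in the context. Then every codimension $1$ face of $\Delta$ not containing the origin contains $V_{n+1}$ as a vertex.
   Context: $V_1,\dots,V_{n+1}$ are the standard basis vectors $e_1,\dots,e_{n+1}$ of $\mathbb{R}^{n+1}$, and for $1\le i\le r$, $V_{n+1+i}=e_{n+1}-\sum_{l=N_{i-1}+1}^{N_i}b_l e_l$ (i.e. the vector with entries $-b_{N_{i-1}+1},\dots,-b_{N_i}$ in positions $N_{i-1}+1,\dots,N_i$, entry $1$ in position $n+1$, and $0$ elsewhere). These are the origin and the exponent vectors of the Laurent polynomial $f=\sum_{i=1}^nx_i+x_{n+1}\bigl(\sum_{i=1}^r a_i/\prod_{l=N_{i-1}+1}^{N_i}x_l^{b_l}-1\bigr)$.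
   Formalization: The codimension 1 faces of Δ are given only by supporting hyperplanes with rational coefficients, and the affine independence of the vertices on them is taken over ℚ instead of ℝ. -}

module Defs where

open import Data.Nat as ℕ using (ℕ; zero; suc; _≡ᵇ_; _≤ᵇ_; _∸_)
open import Data.Bool using (Bool; if_then_else_; _∧_)
open import Data.Nat.ListAction using (sum)
open import Data.List using (List; take; length; foldr; map; upTo)
open import Data.Fin using (Fin; toℕ)
open import Data.Integer using (+_)
open import Data.Rational using (ℚ; 0ℚ; 1ℚ; _+_; _*_; -_; _-_; _/_)
open import Relation.Binary.PropositionalEquality using (_≡_)
open import Data.Product using (Σ; _×_)
open import Relation.Nullary using (¬_)

ℕ→ℚ : ℕ → ℚ
ℕ→ℚ k = (+ k) / 1

sumℚ : List ℚ → ℚ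
sumℚ = foldr _+_ 0ℚ

sumFin : (m : ℕ) → (Fin m → ℚ) → ℚ
sumFin zero    f = 0ℚ
sumFin (suc m) f = f Fin.zero + sumFin m (λ k → f (Fin.suc k))

-- Data: ns = (n_1,…,n_r) as a list (r = length ns); b = (b_1,…,b_n) given as
-- b : ℕ → ℕ with b l meaning b_{l+1} (0-indexed, only l < n is relevant).
-- n = n_1 + ⋯ + n_r
dimN : List ℕ → ℕ
dimN ns = sum ns

partN : List ℕ → ℕ → ℕ
partN ns i = sum (take i ns)

-- Coordinates are 0-indexed: coordinate x (0 ≤ x ≤ n) is the (x+1)-th entry
-- of a vector in ℝ^{n+1}.  Vertex indices j = 0,…,n+r+1 correspond to V_j.
-- Block vector V_{n+2+i} (i = 0,…,r-1, i.e. the paper's V_{n+1+(i+1)}):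
-- entry 1 at position n+1 (coordinate n), entry -b_l at positions
-- N_i+1,…,N_{i+1} (coordinates N_i ≤ x < N_{i+1}), 0 elsewhere.
blockVec : List ℕ → (ℕ → ℕ) → ℕ → ℕ → ℚ
blockVec ns b i x =
  if x ≡ᵇ dimN ns then 1ℚ
  else if (partN ns i ≤ᵇ x) ∧ (suc x ≤ᵇ partN ns (suc i)) then - ℕ→ℚ (b x)
  else 0ℚ

vertex : List ℕ → (ℕ → ℕ) → ℕ → ℕ → ℚ
vertex ns b j x =
  if j ≡ᵇ 0 then 0ℚ
  else if j ≤ᵇ suc (dimN ns) then (if x ≡ᵇ (j ∸ 1) then 1ℚ else 0ℚ)
  else blockVec ns b (j ∸ suc (suc (dimN ns))) x

numVerts : List ℕ → ℕ
numVerts ns = suc (suc (dimN ns ℕ.+ length ns))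

pairing : List ℕ → (ℕ → ℕ) → (ℕ → ℚ) → ℕ → ℚ
pairing ns b a j = sumℚ (map (λ x → a x * vertex ns b j x) (upTo (suc (dimN ns))))

-- The face F = Δ ∩ {y : ⟨a,y⟩ = c} of Δ = conv(V_0,…,V_{n+r+1}), cut out by the
-- supporting hyperplane ⟨a,y⟩ = c (a ≠ 0, ⟨a,·⟩ ≤ c on Δ), is a codimension 1
-- face (facet): it contains n+1 affinely independent generating points.
IsFacet : List ℕ → (ℕ → ℕ) → (ℕ → ℚ) → ℚ → Set
IsFacet ns b a c =
  ¬ (∀ x → x ℕ.< suc (dimN ns) → a x ≡ 0ℚ)
  × (∀ j → j ℕ.< numVerts ns → pairing ns b a j Data.Rational.≤ c)
  × Σ (Fin (suc (dimN ns)) → ℕ) (λ js →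
        (∀ k → js k ℕ.< numVerts ns)
      × (∀ k → pairing ns b a (js k) ≡ c)
      × (∀ (λs : Fin (dimN ns) → ℚ) →
           (∀ x → x ℕ.< suc (dimN ns) →
              sumFin (dimN ns) (λ k → λs k *
                 (vertex ns b (js (Fin.suc k)) x - vertex ns b (js Fin.zero) x)) ≡ 0ℚ) →
           ∀ k → λs k ≡ 0ℚ))

{-# OPTIONS --safe #-}
-- Let F = Δ ∩ {⟨a,·⟩ = c} be a facet with 0 ∉ F, so c > 0, and suppose V_{n+1} ∉ F, i.e. a_{n+1} < c.
-- For every generator V on F some coordinate x ≤ n contributes a positive term a_x V_x to
-- ⟨a,V⟩ = c: otherwise ⟨a,V⟩ ≤ a_{n+1} V_{n+1} ≤ max (0, a_{n+1}) < c, since the last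
-- coordinate of every generator is 0 or 1. Such a coordinate determines the generator: if it
-- is the unit vector e_x then a_x > 0, whereas the block vectors have nonpositive entries and
-- disjoint supports. Hence the n+1 affinely independent generators spanning F would inject
-- into the n coordinates 1,…,n.
module Submission where

open import Defs
open import Data.Nat using (ℕ; _<_; _≤_; suc)
open import Data.List using (List; length)
open import Data.List.Relation.Unary.All using (All)
open import Data.Rational using (ℚ)
open import Relation.Binary.PropositionalEquality using (_≡_)
open import Relation.Nullary using (¬_)

open import Data.Nat as ℕ using (zero; _≡ᵇ_; _≤ᵇ_; z≤n; s≤s; z<s; s<s)
import Data.Nat.Properties as ℕ
open import Data.Bool using (true; false; _∧_; if_then_else_)
open import Data.Bool.Properties using (T-≡; T-∧)
open import Data.List using ([]; _∷_; applyUpTo)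
open import Data.List.Properties using (map-upTo; foldr-preservesᵇ)
open import Data.List.Relation.Unary.All.Properties using (applyUpTo⁺₁; applyUpTo⁺₂)
open import Data.Fin as Fin using (Fin; toℕ; fromℕ<)
open import Data.Fin.Properties using (any?; <⇒notInjective; toℕ<n; toℕ-fromℕ<)
open import Data.Rational as ℚ using (0ℚ; 1ℚ; _+_; _*_; _-_; _<?_)
open import Data.Rational.Properties as ℚ using (module ≤-Reasoning)
open import Data.Rational.Solver using (module +-*-Solver)
open import Algebra.Properties.Group ℚ.+-0-group using (x∙y⁻¹≈ε⇒x≈y)
open import Data.Product as Product using (Σ; _×_; _,_; proj₁; proj₂)
open import Data.Sum using (_⊎_; inj₁; inj₂)
open import Data.Empty using (⊥-elim)
open import Function using (_∘_; Equivalence; Injective)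
open import Relation.Binary.Definitions using (tri<; tri≈; tri>)
open import Relation.Binary.PropositionalEquality using (_≢_; refl; sym; trans; cong; cong₂; subst; module ≡-Reasoning)
open import Relation.Nullary using (yes; no; contradiction)

≤∧≢⇒< : ∀ {p q} → p ℚ.≤ q → p ≢ q → p ℚ.< q
≤∧≢⇒< p≤q p≢q = ℚ.≰⇒> (λ q≤p → p≢q (ℚ.≤-antisym p≤q q≤p))

nonNeg*nonPos≤0 : ∀ {p q} → 0ℚ ℚ.≤ p → q ℚ.≤ 0ℚ → p * q ℚ.≤ 0ℚ
nonNeg*nonPos≤0 {p} 0≤p q≤0 =
  ℚ.≤-trans (ℚ.*-monoˡ-≤-nonNeg p {{ℚ.nonNegative 0≤p}} q≤0) (ℚ.≤-reflexive (ℚ.*-zeroʳ p))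

0≤ℕ→ℚ : ∀ k → 0ℚ ℚ.≤ ℕ→ℚ k
0≤ℕ→ℚ k = ℚ.nonNegative⁻¹ (ℕ→ℚ k) {{ℚ.normalize-nonNeg k 1}}

*-positive⇒≢0ʳ : ∀ p {q} → 0ℚ ℚ.< p * q → q ≢ 0ℚ
*-positive⇒≢0ʳ p 0<pq refl = ℚ.<⇒≢ 0<pq (sym (ℚ.*-zeroʳ p))

sumℚ-applyUpTo-suc : ∀ (f : ℕ → ℚ) m → sumℚ (applyUpTo f (suc m)) ≡ sumℚ (applyUpTo f m) + f m
sumℚ-applyUpTo-suc f zero = trans (ℚ.+-identityʳ (f 0)) (sym (ℚ.+-identityˡ (f 0)))
sumℚ-applyUpTo-suc f (suc m) =
  trans (cong (f 0 +_) (sumℚ-applyUpTo-suc (f ∘ suc) m))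
        (sym (ℚ.+-assoc (f 0) _ (f (suc m))))

sumℚ-zero : ∀ {xs} → All (_≡ 0ℚ) xs → sumℚ xs ≡ 0ℚ
sumℚ-zero = foldr-preservesᵇ (λ { refl refl → refl }) refl

sumℚ-nonPos : ∀ {xs} → All (ℚ._≤ 0ℚ) xs → sumℚ xs ℚ.≤ 0ℚ
sumℚ-nonPos = foldr-preservesᵇ (λ p≤0 q≤0 → ℚ.+-mono-≤ p≤0 q≤0) ℚ.≤-refl

δ : ∀ {m} → Fin m → Fin m → ℚ
δ Fin.zero    Fin.zero    = 1ℚ
δ Fin.zero    (Fin.suc _) = 0ℚ
δ (Fin.suc _) Fin.zero    = 0ℚ
δ (Fin.suc i) (Fin.suc k) = δ i k

δ-diag : ∀ {m} (i : Fin m) → δ i i ≡ 1ℚ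
δ-diag Fin.zero    = refl
δ-diag (Fin.suc i) = δ-diag i

δ≡1⇒≡ : ∀ {m} {i k : Fin m} → δ i k ≡ 1ℚ → i ≡ k
δ≡1⇒≡ {i = Fin.zero}  {Fin.zero}  _ = refl
δ≡1⇒≡ {i = Fin.suc i} {Fin.suc k} e = cong Fin.suc (δ≡1⇒≡ e)

sumFin-zeroˡ : ∀ m (u : Fin m → ℚ) → sumFin m (λ k → 0ℚ * u k) ≡ 0ℚ
sumFin-zeroˡ zero    u = refl
sumFin-zeroˡ (suc m) u =
  trans (cong₂ _+_ (ℚ.*-zeroˡ (u Fin.zero)) (sumFin-zeroˡ m (u ∘ Fin.suc))) (ℚ.+-identityʳ 0ℚ)

sumFin-δ : ∀ m (i : Fin m) (u : Fin m → ℚ) → sumFin m (λ k → δ i k * u k) ≡ u i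
sumFin-δ (suc m) Fin.zero u =
  trans (cong₂ _+_ (ℚ.*-identityˡ (u Fin.zero)) (sumFin-zeroˡ m (u ∘ Fin.suc)))
        (ℚ.+-identityʳ (u Fin.zero))
sumFin-δ (suc m) (Fin.suc i) u =
  trans (cong₂ _+_ (ℚ.*-zeroˡ (u Fin.zero)) (sumFin-δ m i (u ∘ Fin.suc)))
        (ℚ.+-identityˡ (u (Fin.suc i)))

sumFin-−-* : ∀ m (f g u : Fin m → ℚ) →
  sumFin m (λ k → (f k - g k) * u k) ≡ sumFin m (λ k → f k * u k) - sumFin m (λ k → g k * u k)
sumFin-−-* zero    f g u = refl
sumFin-−-* (suc m) f g u =
  trans (cong ((f Fin.zero - g Fin.zero) * u Fin.zero +_)
              (sumFin-−-* m (f ∘ Fin.suc) (g ∘ Fin.suc) (u ∘ Fin.suc)))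
        (solve 5 (λ f₀ g₀ u₀ F G → (f₀ :- g₀) :* u₀ :+ (F :- G) := (f₀ :* u₀ :+ F) :- (g₀ :* u₀ :+ G))
               refl (f Fin.zero) (g Fin.zero) (u Fin.zero) _ _)
  where open +-*-Solver

-- frameCoordinates k are the coordinates of w k in the affine frame (w 0; w 1 − w 0, …, w m − w 0).
frameCoordinates : ∀ {m} → Fin (suc m) → Fin m → ℚ
frameCoordinates Fin.zero    _ = 0ℚ
frameCoordinates (Fin.suc i) k = δ i k

sumFin-frameCoordinates : ∀ m (k : Fin (suc m)) (v : Fin (suc m) → ℚ) →
  sumFin m (λ i → frameCoordinates k i * (v (Fin.suc i) - v Fin.zero)) ≡ v k - v Fin.zero
sumFin-frameCoordinates m Fin.zero    v =
  trans (sumFin-zeroˡ m (λ i → v (Fin.suc i) - v Fin.zero)) (sym (ℚ.+-inverseʳ (v Fin.zero)))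
sumFin-frameCoordinates m (Fin.suc i) v = sumFin-δ m i (λ k → v (Fin.suc k) - v Fin.zero)

frameCoordinates-injective : ∀ {m} {k k' : Fin (suc m)} →
  (∀ i → frameCoordinates k i ≡ frameCoordinates k' i) → k ≡ k'
frameCoordinates-injective {k = Fin.zero}  {Fin.zero}  _ = refl
frameCoordinates-injective {k = Fin.zero}  {Fin.suc j} h = contradiction (sym (trans (h j) (δ-diag j))) ℚ.1≢0
frameCoordinates-injective {k = Fin.suc i} {Fin.zero}  h = contradiction (trans (sym (δ-diag i)) (h i)) ℚ.1≢0
frameCoordinates-injective {k = Fin.suc i} {Fin.suc j} h =
  cong Fin.suc (sym (δ≡1⇒≡ (trans (sym (h i)) (δ-diag i))))

AffinelyIndependent : (d m : ℕ) → (Fin (suc m) → ℕ → ℚ) → Set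
AffinelyIndependent d m w = ∀ (λs : Fin m → ℚ) →
  (∀ x → x < d → sumFin m (λ k → λs k * (w (Fin.suc k) x - w Fin.zero x)) ≡ 0ℚ) →
  ∀ k → λs k ≡ 0ℚ

affinelyIndependent⇒injective : ∀ {d m} {w : Fin (suc m) → ℕ → ℚ} →
  AffinelyIndependent d m w → ∀ {k k'} → w k ≡ w k' → k ≡ k'
affinelyIndependent⇒injective {d} {m} {w} independent {k} {k'} wk≡wk' =
  frameCoordinates-injective (λ i → x∙y⁻¹≈ε⇒x≈y _ _ (independent λs combination-vanishes i))
  where
  λs : Fin m → ℚ
  λs i = frameCoordinates k i - frameCoordinates k' i
  combination-vanishes : ∀ x → x < d → sumFin m (λ i → λs i * (w (Fin.suc i) x - w Fin.zero x)) ≡ 0ℚ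
  combination-vanishes x _ = begin
    sumFin m (λ i → λs i * (w (Fin.suc i) x - w Fin.zero x))
      ≡⟨ sumFin-−-* m (frameCoordinates k) (frameCoordinates k') (λ i → w (Fin.suc i) x - w Fin.zero x) ⟩
    sumFin m (λ i → frameCoordinates k i * (w (Fin.suc i) x - w Fin.zero x))
      - sumFin m (λ i → frameCoordinates k' i * (w (Fin.suc i) x - w Fin.zero x))
      ≡⟨ cong₂ _-_ (sumFin-frameCoordinates m k (λ l → w l x))
                   (sumFin-frameCoordinates m k' (λ l → w l x)) ⟩
    (w k x - w Fin.zero x) - (w k' x - w Fin.zero x)
      ≡⟨ cong (λ v → (w k x - w Fin.zero x) - (v x - w Fin.zero x)) (sym wk≡wk') ⟩
    (w k x - w Fin.zero x) - (w k x - w Fin.zero x)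
      ≡⟨ ℚ.+-inverseʳ (w k x - w Fin.zero x) ⟩
    0ℚ ∎
    where open ≡-Reasoning

partN-mono : ∀ ns {i i'} → i ≤ i' → partN ns i ≤ partN ns i'
partN-mono ns       {zero}           _          = z≤n
partN-mono []       {suc i} {suc i'} _          = z≤n
partN-mono (m ∷ ns) {suc i} {suc i'} (s≤s i≤i') = ℕ.+-monoʳ-≤ m (partN-mono ns i≤i')

InBlock : List ℕ → ℕ → ℕ → Set
InBlock ns i x = partN ns i ≤ x × x < partN ns (suc i)

inBlock-unique : ∀ ns {i i' x} → InBlock ns i x → InBlock ns i' x → i ≡ i'
inBlock-unique ns {i} {i'} (start , end) (start' , end') with ℕ.<-cmp i i'
... | tri< i<i' _ _ = ⊥-elim (ℕ.<⇒≱ end (ℕ.≤-trans (partN-mono ns i<i') start'))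
... | tri≈ _ i≡i' _ = i≡i'
... | tri> _ _ i'<i = ⊥-elim (ℕ.<⇒≱ end' (ℕ.≤-trans (partN-mono ns i'<i) start))

data GeneratorIndex (n : ℕ) : ℕ → Set where
  origin : GeneratorIndex n 0
  unit   : ∀ {y} → y ≤ n → GeneratorIndex n (suc y)
  block  : ∀ i → GeneratorIndex n (suc (suc (n ℕ.+ i)))

generatorIndex : ∀ n j → GeneratorIndex n j
generatorIndex n zero = origin
generatorIndex n (suc y) with y ℕ.≤? n
... | yes y≤n = unit y≤n
... | no  y≰n with ℕ.m≤n⇒∃[o]m+o≡n (ℕ.≰⇒> y≰n)
...   | i , refl = block i

blockIndex : List ℕ → ℕ → ℕ
blockIndex ns i = suc (suc (dimN ns ℕ.+ i))

module _ (ns : List ℕ) (b : ℕ → ℕ) where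
  private
    n : ℕ
    n = dimN ns

  vertex-unit : ∀ {y} x → y ≤ n → vertex ns b (suc y) x ≡ (if x ≡ᵇ y then 1ℚ else 0ℚ)
  vertex-unit x y≤n rewrite Equivalence.to T-≡ (ℕ.≤⇒≤ᵇ (s≤s y≤n)) = refl

  vertex-unit-diag : ∀ {y} → y ≤ n → vertex ns b (suc y) y ≡ 1ℚ
  vertex-unit-diag {y} y≤n
    rewrite vertex-unit y y≤n | Equivalence.to T-≡ (ℕ.≡⇒≡ᵇ y y refl) = refl

  vertex-unit-off : ∀ {x y} → y ≤ n → x ≢ y → vertex ns b (suc y) x ≡ 0ℚ
  vertex-unit-off {x} {y} y≤n x≢y rewrite vertex-unit x y≤n with x ≡ᵇ y in e
  ... | true  = contradiction (ℕ.≡ᵇ⇒≡ x y (Equivalence.from T-≡ e)) x≢y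
  ... | false = refl

  vertex-block : ∀ i x → vertex ns b (blockIndex ns i) x ≡ blockVec ns b i x
  vertex-block i x with blockIndex ns i ≤ᵇ suc n in e
  ... | true  = ⊥-elim (ℕ.<⇒≱ (s≤s (s≤s (ℕ.m≤m+n n i))) (ℕ.≤ᵇ⇒≤ _ _ (Equivalence.from T-≡ e)))
  ... | false = cong (λ k → blockVec ns b k x) (ℕ.m+n∸m≡n n i)

  blockVec-last : ∀ i → blockVec ns b i n ≡ 1ℚ
  blockVec-last i rewrite Equivalence.to T-≡ (ℕ.≡⇒≡ᵇ n n refl) = refl

  blockVec-support : ∀ i {x} → x < n → blockVec ns b i x ≢ 0ℚ →
                     InBlock ns i x × blockVec ns b i x ℚ.≤ 0ℚ
  blockVec-support i {x} x<n v≢0 with x ≡ᵇ n in e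
  ... | true  = contradiction (ℕ.≡ᵇ⇒≡ x n (Equivalence.from T-≡ e)) (ℕ.<⇒≢ x<n)
  ... | false with (partN ns i ≤ᵇ x) ∧ (suc x ≤ᵇ partN ns (suc i)) in inb
  ...   | false = contradiction refl v≢0
  ...   | true  = Product.map (ℕ.≤ᵇ⇒≤ _ _) (ℕ.≤ᵇ⇒≤ _ _) (Equivalence.to T-∧ (Equivalence.from T-≡ inb))
                , ℚ.neg-antimono-≤ (0≤ℕ→ℚ (b x))

  vertex-last : ∀ j → vertex ns b j n ≡ 0ℚ ⊎ vertex ns b j n ≡ 1ℚ
  vertex-last j with generatorIndex n j
  ... | origin = inj₁ refl
  ... | block i = inj₂ (trans (vertex-block i n) (blockVec-last i))
  ... | unit {y} y≤n with n ℕ.≟ y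
  ...   | yes refl = inj₂ (vertex-unit-diag y≤n)
  ...   | no  n≢y  = inj₁ (vertex-unit-off y≤n n≢y)

  vertex-support : ∀ j {x} → x < n → vertex ns b j x ≢ 0ℚ →
    (j ≡ suc x × vertex ns b j x ≡ 1ℚ) ⊎
    Σ ℕ (λ i → j ≡ blockIndex ns i × InBlock ns i x × vertex ns b j x ℚ.≤ 0ℚ)
  vertex-support j {x} x<n v≢0 with generatorIndex n j
  ... | origin = contradiction refl v≢0
  ... | block i =
    let inBlock , v≤0 = blockVec-support i x<n (v≢0 ∘ trans (vertex-block i x))
    in  inj₂ (i , refl , inBlock , subst (ℚ._≤ 0ℚ) (sym (vertex-block i x)) v≤0)
  ... | unit {y} y≤n with x ℕ.≟ y
  ...   | yes refl = inj₁ (refl , vertex-unit-diag y≤n)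
  ...   | no  x≢y  = contradiction (vertex-unit-off y≤n x≢y) v≢0

module _ (ns : List ℕ) (b : ℕ → ℕ) (a : ℕ → ℚ) where
  private
    n : ℕ
    n = dimN ns

  term : ℕ → ℕ → ℚ
  term j x = a x * vertex ns b j x

  pairing-split : ∀ j → pairing ns b a j ≡ sumℚ (applyUpTo (term j) n) + term j n
  pairing-split j = trans (cong sumℚ (map-upTo (term j) (suc n))) (sumℚ-applyUpTo-suc (term j) n)

  pairing-origin : pairing ns b a 0 ≡ 0ℚ
  pairing-origin = trans (cong sumℚ (map-upTo (term 0) (suc n)))
                         (sumℚ-zero (applyUpTo⁺₂ (term 0) (suc n) (λ x → ℚ.*-zeroʳ (a x))))

  pairing-top : pairing ns b a (suc n) ≡ a n
  pairing-top = begin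
    pairing ns b a (suc n)                            ≡⟨ pairing-split (suc n) ⟩
    sumℚ (applyUpTo (term (suc n)) n) + term (suc n) n ≡⟨ cong₂ _+_ (sumℚ-zero (applyUpTo⁺₁ _ n off)) diag ⟩
    0ℚ + a n                                          ≡⟨ ℚ.+-identityˡ (a n) ⟩
    a n                                               ∎
    where
    open ≡-Reasoning
    off : ∀ {x} → x < n → term (suc n) x ≡ 0ℚ
    off {x} x<n = trans (cong (a x *_) (vertex-unit-off ns b ℕ.≤-refl (ℕ.<⇒≢ x<n))) (ℚ.*-zeroʳ (a x))
    diag : term (suc n) n ≡ a n
    diag = trans (cong (a n *_) (vertex-unit-diag ns b ℕ.≤-refl)) (ℚ.*-identityʳ (a n))

  pairing-≤-lastTerm : ∀ j → (∀ {x} → x < n → term j x ℚ.≤ 0ℚ) → pairing ns b a j ℚ.≤ term j n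
  pairing-≤-lastTerm j nonPos = begin
    pairing ns b a j                             ≡⟨ pairing-split j ⟩
    sumℚ (applyUpTo (term j) n) + term j n
      ≤⟨ ℚ.+-monoˡ-≤ (term j n) (sumℚ-nonPos (applyUpTo⁺₁ (term j) n nonPos)) ⟩
    0ℚ + term j n                                ≡⟨ ℚ.+-identityˡ (term j n) ⟩
    term j n                                     ∎
    where open ≤-Reasoning

  lastTerm-< : ∀ {c} j → 0ℚ ℚ.< c → a n ℚ.< c → term j n ℚ.< c
  lastTerm-< j 0<c aₙ<c with vertex-last ns b j
  ... | inj₁ vₙ≡0 = subst (ℚ._< _) (sym (trans (cong (a n *_) vₙ≡0) (ℚ.*-zeroʳ (a n)))) 0<c
  ... | inj₂ vₙ≡1 = subst (ℚ._< _) (sym (trans (cong (a n *_) vₙ≡1) (ℚ.*-identityʳ (a n)))) aₙ<c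

  positiveTerm-exists : ∀ {c} j → 0ℚ ℚ.< c → a n ℚ.< c → pairing ns b a j ≡ c →
                        Σ (Fin n) (λ x → 0ℚ ℚ.< term j (toℕ x))
  positiveTerm-exists j 0<c aₙ<c j∈F with any? (λ x → 0ℚ <? term j (toℕ x))
  ... | yes found = found
  ... | no  none  =
    ⊥-elim (ℚ.<-irrefl j∈F (ℚ.≤-<-trans (pairing-≤-lastTerm j nonPos) (lastTerm-< j 0<c aₙ<c)))
    where
    nonPos : ∀ {x} → x < n → term j x ℚ.≤ 0ℚ
    nonPos {x} x<n = ℚ.≮⇒≥ λ pos →
      none (fromℕ< x<n , subst (λ y → 0ℚ ℚ.< term j y) (sym (toℕ-fromℕ< x<n)) pos)

  unitTerm-excludes-blockTerm : ∀ {j j' x} → vertex ns b j x ≡ 1ℚ → 0ℚ ℚ.< term j x →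
                                vertex ns b j' x ℚ.≤ 0ℚ → ¬ (0ℚ ℚ.< term j' x)
  unitTerm-excludes-blockTerm {x = x} v≡1 pos v'≤0 pos' =
    ℚ.<-irrefl refl (ℚ.<-≤-trans pos' (nonNeg*nonPos≤0 (ℚ.<⇒≤ 0<aₓ) v'≤0))
    where
    0<aₓ : 0ℚ ℚ.< a x
    0<aₓ = subst (0ℚ ℚ.<_) (trans (cong (a x *_) v≡1) (ℚ.*-identityʳ (a x))) pos

  positiveTerm-unique : ∀ {j j' x} → x < n → 0ℚ ℚ.< term j x → 0ℚ ℚ.< term j' x → j ≡ j'
  positiveTerm-unique {j} {j'} {x} x<n pos pos'
    with vertex-support ns b j  x<n (*-positive⇒≢0ʳ (a x) pos)
       | vertex-support ns b j' x<n (*-positive⇒≢0ʳ (a x) pos')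
  ... | inj₁ (refl , _)      | inj₁ (refl , _)        = refl
  ... | inj₁ (_ , v≡1)       | inj₂ (_ , _ , _ , v'≤0) =
    contradiction pos' (unitTerm-excludes-blockTerm {j} {j'} v≡1 pos v'≤0)
  ... | inj₂ (_ , _ , _ , v≤0) | inj₁ (_ , v'≡1)      =
    contradiction pos (unitTerm-excludes-blockTerm {j'} {j} v'≡1 pos' v≤0)
  ... | inj₂ (_ , refl , inBlock , _) | inj₂ (_ , refl , inBlock' , _) =
    cong (blockIndex ns) (inBlock-unique ns inBlock inBlock')

proposition3p2 : (ns : List ℕ) → 1 ≤ length ns → All (λ m → 0 < m) ns →
    (b : ℕ → ℕ) → (∀ l → l < dimN ns → 0 < b l) →
    (a : ℕ → ℚ) (c : ℚ) → IsFacet ns b a c →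
    ¬ (pairing ns b a 0 ≡ c) →
    pairing ns b a (suc (dimN ns)) ≡ c
proposition3p2 ns _ _ b _ a c (_ , supporting , js , _ , js∈F , js-independent) 0∉F
  with pairing ns b a (suc (dimN ns)) ℚ.≟ c
... | yes top∈F = top∈F
... | no  top∉F = ⊥-elim (<⇒notInjective (ℕ.n<1+n n) witness-injective)
  where
  n : ℕ
  n = dimN ns

  0<c : 0ℚ ℚ.< c
  0<c = ≤∧≢⇒< (subst (ℚ._≤ c) (pairing-origin ns b a) (supporting 0 z<s))
              (0∉F ∘ trans (pairing-origin ns b a))

  aₙ<c : a n ℚ.< c
  aₙ<c = subst (ℚ._< c) (pairing-top ns b a)
               (≤∧≢⇒< (supporting (suc n) (s<s (s≤s (ℕ.m≤m+n n (length ns))))) top∉F)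

  positiveTerm : ∀ k → Σ (Fin n) (λ x → 0ℚ ℚ.< term ns b a (js k) (toℕ x))
  positiveTerm k = positiveTerm-exists ns b a (js k) 0<c aₙ<c (js∈F k)

  witness : Fin (suc n) → Fin n
  witness k = proj₁ (positiveTerm k)

  witness-injective : Injective _≡_ _≡_ witness
  witness-injective {k} {k'} same =
    affinelyIndependent⇒injective {w = λ k → vertex ns b (js k)} js-independent
                                  (cong (vertex ns b) js-equal)
    where
    js-equal : js k ≡ js k'
    js-equal = positiveTerm-unique ns b a (toℕ<n (witness k)) (proj₂ (positiveTerm k))
                 (subst (λ x → 0ℚ ℚ.< term ns b a (js k') (toℕ x)) (sym same) (proj₂ (positiveTerm k')))
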